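{- Let $\mathcal O$ be the DL-Lite$^{\mathcal H}$ ontology $\{A\sqsubseteq\exists R,\ \exists R^-\sqsubseteq A,\ R^-\sqsubseteq S\}$ for a concept name $A$ and role names $R,S$. Then $\mathcal{L}(\exists,\sqcap)$ does not admit finite characterisations under $\mathcal O$.
   Context: $\mathcal{L}(\exists,\sqcap)[\Sigma_C,\Sigma_R]$ is the set of concepts $C ::= B\mid C\sqcap C\mid\exists T.C$ with $B$ in a finite set $\Sigma_C$ of concept names and $T$ in a finite set $\Sigma_R$ of role names, standard semantics. $\exists T$ abbreviates $\exists T.\top$ and $(R^-)^{\mathcal I}$ is the converse of $R^{\mathcal I}$. DL-Lite$^{\mathcal H}$ extends DL-Lite with role inclusions; $\mathcal I\models\mathcal O$ if $A^{\mathcal I}\subseteq(\exists R)^{\mathcal I}$, $(\exists R^-)^{\mathcal I}\subseteq A^{\mathcal I}$ and $(R^-)^{\mathcal I}\subseteq S^{\mathcal I}$. $C\equiv_{\mathcal O}D$ if $C^{\mathcal I}=D^{\mathcal I}$ for all $\mathcal I\models\mathcal O$. An example for $\mathcal O$ is a finite pointed interpretation $(\mathcal I,d)$ with $\mathcal I\models\mathcal O$, labelled positive or negative; $C$ fits $E=(E^+,E^-)$ if $d\in C^{\mathcal I}$ for positive and $d\notin C^{\mathcal I}$ for negative examples. A finite characterisation of $C$ w.r.t. $\mathcal L$ under $\mathcal O$ is a finite collection $E$ of examples for $\mathcal O$ that $C$ fits such that every $D\in\mathcal L$ fitting $E$ satisfies $C\equiv_{\mathcal O}D$. $\mathcal L$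 admits finite characterisations under $\mathcal O$ if for all finite $\Sigma_C,\Sigma_R$, every $C\in\mathcal L[\Sigma_C,\Sigma_R]$ has such a characterisation w.r.t. $\mathcal L[\Sigma_C,\Sigma_R]$ under $\mathcal O$. -}

module Defs where

open import Data.Nat using (ℕ)
open import Data.Fin using (Fin)
open import Data.List using (List)
open import Data.List.Membership.Propositional using (_∈_)
open import Data.List.Relation.Unary.All using (All)
open import Data.Product using (Σ; _×_; Σ-syntax)
open import Data.Unit using (⊤)
open import Data.Empty using (⊥)
open import Level using (Level; suc; zero)

CName : Set
CName = ℕ

RName : Set
RName = ℕ

data Concept : Set where
  top  : Concept
  cn   : CName → Concept
  _⊓_  : Concept → Concept → Concept
  ex   : RName → Concept → Concept

InSig : List CName → List RName → Concept → Set
InSig ΣC ΣR top       = ⊤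
InSig ΣC ΣR (cn B)    = B ∈ ΣC
InSig ΣC ΣR (C ⊓ D)   = InSig ΣC ΣR C × InSig ΣC ΣR D
InSig ΣC ΣR (ex T C)  = T ∈ ΣR × InSig ΣC ΣR C

record Interp (Δ : Set) : Set₁ where
  field
    conc : CName → Δ → Set
    role : RName → Δ → Δ → Set
open Interp public

Sat : {Δ : Set} → Interp Δ → Δ → Concept → Set
Sat I d top      = ⊤
Sat I d (cn B)   = conc I B d
Sat I d (C ⊓ D)  = Sat I d C × Sat I d D
Sat {Δ} I d (ex T C) = Σ[ e ∈ Δ ] (role I T d e × Sat I e C)

record Model (A : CName) (R S : RName) {Δ : Set} (I : Interp Δ) : Set where
  field
    ax1 : ∀ d → conc I A d → Σ[ e ∈ Δ ] role I R d e
    ax2 : ∀ d e → role I R e d → conc I A d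
    ax3 : ∀ d e → role I R e d → role I S d e

-- C ≡_O D : same extension in every (arbitrary) model of O
EquivO : CName → RName → RName → Concept → Concept → Set₁
EquivO A R S C D = (Δ : Set) (I : Interp Δ) → Model A R S I →
  (d : Δ) → (Sat I d C → Sat I d D) × (Sat I d D → Sat I d C)

record Example (A : CName) (R S : RName) : Set₁ where
  field
    size  : ℕ
    int   : Interp (Fin size)
    model : Model A R S int
    point : Fin size
open Example public

Fits : {A : CName} {R S : RName} → Concept → List (Example A R S) → List (Example A R S) → Set₁
Fits C E⁺ E⁻ =
  All (λ ex → Sat (int ex) (point ex) C) E⁺ ×
  All (λ ex → Sat (int ex) (point ex) C → ⊥) E⁻

FiniteChar : CName → RName → RName → List CName → List RName → Concept → Set₁
FiniteChar A R S ΣC ΣR C =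
  Σ[ E⁺ ∈ List (Example A R S) ] Σ[ E⁻ ∈ List (Example A R S) ]
    (Fits C E⁺ E⁻ ×
     ((D : Concept) → InSig ΣC ΣR D → Fits D E⁺ E⁻ → EquivO A R S C D))

AdmitsFC : CName → RName → RName → Set₁
AdmitsFC A R S = (ΣC : List CName) (ΣR : List RName) (C : Concept) →
  InSig ΣC ΣR C → FiniteChar A R S ΣC ΣR C

-- In a finite model of O, following A ⊑ ∃R and ∃R⁻ ⊑ A from an instance of A
-- yields an R-path which, by the pigeonhole principle, closes a cycle within
-- |Δ| steps. R⁻ ⊑ S turns that cycle into an S-cycle, so after M ≥ |Δ| R-steps
-- arbitrarily long S-paths exist: every finite example satisfying A satisfies
-- A ⊓ ∃Rᴹ.∃Sᴹ⁺¹.⊤. The infinite model (ℕ, R = successor, S = predecessor)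
-- separates A from that concept at 0, so no finite set of examples pins A down.
module Submission where

open import Defs
open import Relation.Binary.PropositionalEquality using (_≡_; _≢_; refl; sym; cong; subst)
open import Relation.Nullary using (¬_)
open import Function using (_∘_)
open import Data.Nat using (ℕ; zero; suc; _+_; _∸_; _≤_; _<_; z≤n; s≤s)
open import Data.Nat.Properties using (m∸n+n≡m; +-suc; +-identityʳ; <-irrefl; ≤-trans; <⇒≤; ≤-pred)
open import Data.Fin using (Fin; toℕ)
open import Data.Fin.Properties using (pigeonhole; toℕ<n)
open import Data.List using (List; []; _∷_; map)
open import Data.List.Extrema.Nat using (max; xs≤max)
open import Data.List.Membership.Propositional using (_∈_)
open import Data.List.Relation.Unary.All as All using (All)
open import Data.List.Relation.Unary.All.Properties using (map⁻)
open import Data.List.Relation.Unary.Any using (here; there)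
open import Data.Product using (Σ; Σ-syntax; _×_; _,_; proj₁; proj₂)
open import Data.Sum using (_⊎_; inj₁; inj₂)
open import Data.Unit using (⊤; tt)
open import Data.Empty using (⊥-elim)

exs : RName → ℕ → Concept → Concept
exs T zero    C = C
exs T (suc n) C = ex T (exs T n C)

InSig-exs : ∀ {ΣC ΣR T C} n → T ∈ ΣR → InSig ΣC ΣR C → InSig ΣC ΣR (exs T n C)
InSig-exs zero    T∈ΣR C∈Σ = C∈Σ
InSig-exs (suc n) T∈ΣR C∈Σ = T∈ΣR , InSig-exs n T∈ΣR C∈Σ

module _ {Δ : Set} (I : Interp Δ) (T : RName) where

  path⇒exs : (s : ℕ → Δ) → (∀ k → role I T (s k) (s (suc k))) →
             ∀ {C} n → Sat I (s n) C → Sat I (s 0) (exs T n C)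
  path⇒exs s step zero    sₙ∈C = sₙ∈C
  path⇒exs s step (suc n) sₙ∈C = s 1 , step 0 , path⇒exs (s ∘ suc) (step ∘ suc) n sₙ∈C

  closed⇒exs : (P : Δ → Set) → (∀ x → P x → Σ[ y ∈ Δ ] (role I T x y × P y)) →
               ∀ {C} → (∀ x → P x → Sat I x C) → ∀ n x → P x → Sat I x (exs T n C)
  closed⇒exs P succ P⊆C zero    x Px = P⊆C x Px
  closed⇒exs P succ P⊆C (suc n) x Px with succ x Px
  ... | y , xTy , Py = y , xTy , closed⇒exs P succ P⊆C n y Py

module FiniteModel (A : CName) (R S : RName) {N : ℕ} {I : Interp (Fin N)}
                   (model : Model A R S I) where
  open Model model

  R-path : (d : Fin N) → conc I A d → ℕ → Σ (Fin N) (conc I A)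
  R-path d d∈A zero    = d , d∈A
  R-path d d∈A (suc k) with R-path d d∈A k
  ... | e , e∈A with ax1 e e∈A
  ...   | f , eRf = f , ax2 f e eRf

  module _ (d : Fin N) (d∈A : conc I A d) where
    s : ℕ → Fin N
    s = proj₁ ∘ R-path d d∈A

    s-R : ∀ k → role I R (s k) (s (suc k))
    s-R k with R-path d d∈A k
    ... | e , e∈A = proj₂ (ax1 e e∈A)

    s-S : ∀ k → role I S (s (suc k)) (s k)
    s-S k = ax3 (s (suc k)) (s k) (s-R k)

    -- The cycle s i ≡ s j gives s i the S-successor s (j ∸ 1), which lies in the tail again.
    tail-S-closed : ∀ {i j} → i < j → s i ≡ s j →
                    ∀ x → Σ[ k ∈ ℕ ] x ≡ s (k + i) →
                    Σ[ y ∈ Fin N ] (role I S x y × Σ[ k ∈ ℕ ] y ≡ s (k + i))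
    tail-S-closed {i} {suc j} (s≤s i≤j) sᵢ≡sⱼ x (zero , refl) =
      s j , subst (λ z → role I S z (s j)) (sym sᵢ≡sⱼ) (s-S j) ,
      j ∸ i , cong s (sym (m∸n+n≡m i≤j))
    tail-S-closed i<j sᵢ≡sⱼ x (suc k , refl) = s (k + _) , s-S (k + _) , k , refl

    exs-R-S : ∀ M K → N ≤ M → Sat I d (exs R M (exs S K top))
    exs-R-S M K N≤M with pigeonhole (s≤s N≤M) (s ∘ toℕ)
    ... | i , j , i<j , sᵢ≡sⱼ =
      path⇒exs I R s s-R M
        (closed⇒exs I S _ (tail-S-closed i<j sᵢ≡sⱼ) (λ _ _ → tt) K (s M)
          (M ∸ toℕ i , cong s (sym (m∸n+n≡m i≤M))))
      where
      i≤M : toℕ i ≤ M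
      i≤M = ≤-trans (<⇒≤ i<j) (≤-pred (toℕ<n j))

module NaturalNumberModel (A : CName) (R S : RName) (R≢S : R ≢ S) where

  ℕ-interp : Interp ℕ
  ℕ-interp = record
    { conc = λ _ _ → ⊤
    ; role = λ T d e → (T ≡ R × e ≡ suc d) ⊎ (T ≡ S × d ≡ suc e)
    }

  ℕ-model : Model A R S ℕ-interp
  ℕ-model = record
    { ax1 = λ d _ → suc d , inj₁ (refl , refl)
    ; ax2 = λ _ _ _ → tt
    ; ax3 = λ { d e (inj₁ (_ , e≡1+d)) → inj₂ (refl , e≡1+d)
              ; d e (inj₂ (R≡S , _))   → ⊥-elim (R≢S R≡S) }
    }

  exs-R-shift : ∀ {C} n m → Sat ℕ-interp m (exs R n C) → Sat ℕ-interp (n + m) C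
  exs-R-shift zero    m m∈C = m∈C
  exs-R-shift {C} (suc n) m (_ , inj₁ (_ , refl) , m+1∈C) =
    subst (λ k → Sat ℕ-interp k C) (+-suc n m) (exs-R-shift n (suc m) m+1∈C)
  exs-R-shift (suc n) m (_ , inj₂ (R≡S , _) , _) = ⊥-elim (R≢S R≡S)

  exs-S-bound : ∀ n m → Sat ℕ-interp m (exs S n top) → n ≤ m
  exs-S-bound zero    m       _ = z≤n
  exs-S-bound (suc n) m       (_ , inj₁ (S≡R , _) , _) = ⊥-elim (R≢S (sym S≡R))
  exs-S-bound (suc n) (suc m) (_ , inj₂ (_ , refl) , m⊨S) = s≤s (exs-S-bound n m m⊨S)

  zero∉exs-R-S : ∀ M → ¬ Sat ℕ-interp 0 (exs R M (exs S (suc M) top))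
  zero∉exs-R-S M 0∈C = <-irrefl refl M<M
    where
    M<M : M < M
    M<M = subst (suc M ≤_) (+-identityʳ M) (exs-S-bound (suc M) (M + 0) (exs-R-shift M 0 0∈C))

⊓-fits : ∀ {A R S C X} {E⁺ E⁻ : List (Example A R S)} → Fits C E⁺ E⁻ →
         All (λ e → Sat (int e) (point e) X) E⁺ → Fits (C ⊓ X) E⁺ E⁻
⊓-fits (E⁺⊨C , E⁻⊭C) E⁺⊨X = All.zip (E⁺⊨C , E⁺⊨X) , All.map (λ e⊭C → e⊭C ∘ proj₁) E⁻⊭C

theorem17 : (A : CName) (R S : RName) → R ≢ S → ¬ AdmitsFC A R S
theorem17 A R S R≢S admits
  with admits (A ∷ []) (R ∷ S ∷ []) (cn A) (here refl)
... | E⁺ , E⁻ , A-fits@(E⁺⊨A , _) , characterises =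
  zero∉exs-R-S M (proj₂ (proj₁ (A≡D ℕ ℕ-interp ℕ-model 0) tt))
  where
  open NaturalNumberModel A R S R≢S
  M : ℕ
  M = max 0 (map size E⁺)
  X : Concept
  X = exs R M (exs S (suc M) top)
  E⁺⊨X : All (λ e → Sat (int e) (point e) X) E⁺
  E⁺⊨X = All.zipWith
    (λ {e} (size≤M , e⊨A) → FiniteModel.exs-R-S A R S (model e) (point e) e⊨A M (suc M) size≤M)
    (map⁻ (xs≤max 0 (map size E⁺)) , E⁺⊨A)
  A≡D : EquivO A R S (cn A) (cn A ⊓ X)
  A≡D = characterises (cn A ⊓ X)
    (here refl , InSig-exs M (here refl) (InSig-exs (suc M) (there (here refl)) tt))
    (⊓-fits {X = X} A-fits E⁺⊨X)
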